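{- Let $G$ be a finite simple graph and $e \in E(G)$. Then $\gamma_{gr}^L(G) - 1 \leq \gamma_{gr}^L(G - e) \leq \gamma_{gr}^L(G) + 2$, where $G - e$ is the graph obtained from $G$ by deleting the edge $e$.
   Context: For a vertex $v$, $N(v)$ is its open neighborhood (the set of its neighbors) and $N[v] = N(v) \cup \{v\}$ its closed neighborhood. An L-sequence of a graph $G$ is a sequence $(v_1, \ldots, v_k)$ of distinct vertices of $G$ such that for every $i \in \{1,\ldots,k\}$, $N[v_i] \setminus \bigcup_{j=1}^{i-1} N(v_j) \neq \emptyset$. The L-Grundy domination number $\gamma_{gr}^L(G)$ is the maximum length of an L-sequence of $G$. -}

module Defs where

open import Data.Nat using (ℕ)
open import Data.Fin using (Fin; _≟_)
open import Data.Bool using (Bool; true; false; _∧_; _∨_; not)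
open import Data.Bool.Properties using (∨-comm)
open import Data.List using (List; []; _∷_; length)
open import Data.List.Relation.Unary.All using (All)
open import Data.List.Relation.Unary.Unique.Propositional using (Unique)
open import Data.Product using (Σ; ∃; _×_; _,_)
open import Data.Sum using (_⊎_)
open import Data.Unit using (⊤)
open import Relation.Nullary.Decidable using (⌊_⌋)
open import Relation.Binary.PropositionalEquality using (_≡_; refl; cong; cong₂)

record Graph (n : ℕ) : Set where
  field
    adj    : Fin n → Fin n → Bool
    sym    : ∀ x y → adj x y ≡ adj y x
    irrefl : ∀ x → adj x x ≡ false
open Graph public

Edge : ∀ {n} → Graph n → Set
Edge {n} G = Σ (Fin n) λ u → Σ (Fin n) λ v → adj G u v ≡ true

isPair : ∀ {n} → Fin n → Fin n → Fin n → Fin n → Bool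
isPair u v x y = (⌊ x ≟ u ⌋ ∧ ⌊ y ≟ v ⌋) ∨ (⌊ y ≟ u ⌋ ∧ ⌊ x ≟ v ⌋)

deleteEdge : ∀ {n} (G : Graph n) → Edge G → Graph n
deleteEdge G (u , v , _) = record
  { adj    = λ x y → adj G x y ∧ not (isPair u v x y)
  ; sym    = λ x y → cong₂ (λ a b → a ∧ not b) (sym G x y)
                       (∨-comm (⌊ x ≟ u ⌋ ∧ ⌊ y ≟ v ⌋) (⌊ y ≟ u ⌋ ∧ ⌊ x ≟ v ⌋))
  ; irrefl = λ x → cong (λ a → a ∧ not (isPair u v x x)) (irrefl G x)
  }

InClosedNbhd : ∀ {n} → Graph n → Fin n → Fin n → Set
InClosedNbhd G v w = (w ≡ v) ⊎ (adj G v w ≡ true)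

Footprinted : ∀ {n} → Graph n → List (Fin n) → Fin n → Set
Footprinted {n} G prev v =
  ∃ λ (w : Fin n) → InClosedNbhd G v w × All (λ u → adj G u w ≡ false) prev

-- the condition along the sequence, with the (reversed) list of earlier vertices
LCond : ∀ {n} → Graph n → List (Fin n) → List (Fin n) → Set
LCond G prev []       = ⊤
LCond G prev (v ∷ vs) = Footprinted G prev v × LCond G (v ∷ prev) vs

IsLSequence : ∀ {n} → Graph n → List (Fin n) → Set
IsLSequence G s = Unique s × LCond G [] s

IsLGrundyNumber : ∀ {n} → Graph n → ℕ → Set
IsLGrundyNumber {n} G k =
  (∃ λ (s : List (Fin n)) → IsLSequence G s × length s ≡ k)
  × (∀ (s : List (Fin n)) → IsLSequence G s → length s Data.Nat.≤ k)

{-# OPTIONS --safe #-}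
-- Deleting the edge ab cannot shorten an L-sequence by more than one vertex: only the
-- vertex whose footprint is the edge ab itself can break. If that vertex is not dominated
-- by its predecessors it footprints itself; otherwise it is dropped, and since it is then
-- dominated it can be nobody's later footprint, so ab is never again used as a footprint
-- edge. Conversely G and G - ab agree at every vertex other than a and b, so removing a
-- and b from an L-sequence of G - ab leaves an L-sequence of G, two vertices shorter.
module Submission where

open import Defs hiding (sym)
open import Data.Bool as Bool using (true; false; _∧_; not)
open import Data.Bool.Properties using (¬-not; ∧-zeroʳ; ∧-identityʳ)
open import Data.Fin using (Fin; _≟_)
open import Data.List using (List; []; _∷_; length; filter)
open import Data.List.Membership.Propositional using (_∈_; _∉_)
import Data.List.Membership.DecPropositional as DecMembership
open import Data.List.Membership.Propositional.Properties using (∈-filter⁺; ∈-filter⁻)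
open import Data.List.Properties using (filter-notAll)
open import Data.List.Relation.Binary.Subset.Propositional using (_⊆_)
open import Data.List.Relation.Binary.Subset.Propositional.Properties using (∷⁺ʳ; xs⊆x∷xs)
open import Data.List.Relation.Unary.All as All using (All; []; _∷_)
open import Data.List.Relation.Unary.All.Properties using (anti-mono; ¬Any⇒All¬; All¬⇒¬Any)
open import Data.List.Relation.Unary.Any as Any using (Any; here; there; any?)
open import Data.List.Relation.Unary.AllPairs using ([]; _∷_)
open import Data.List.Relation.Unary.Unique.Propositional using (Unique)
import Data.List.Relation.Unary.Unique.Propositional.Properties as Unique
open import Data.Nat using (ℕ; suc; _≤_; _+_; _∸_; z≤n; s≤s)
open import Data.Nat.Properties
  using (≤-refl; ≤-trans; ≤-<-trans; +-suc; +-monoʳ-≤; +-monoˡ-≤; ∸-monoˡ-≤; module ≤-Reasoning)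
open import Data.Product using (∃; _×_; _,_; proj₁; proj₂)
open import Data.Sum using (_⊎_; inj₁; inj₂)
open import Data.Unit using (tt)
open import Level using (Level)
open import Relation.Binary.Definitions using (DecidableEquality)
open import Relation.Binary.PropositionalEquality using (_≡_; _≢_; refl; sym; trans; cong)
open import Relation.Nullary using (yes; no; ¬?; contradiction)
open import Relation.Nullary.Decidable using (decidable-stable)
open import Relation.Unary using (Pred; Decidable; ∁)
open import Relation.Unary.Properties using (∁?)

module _ {a : Level} {A : Set a} (_≟ᴬ_ : DecidableEquality A) where
  open DecMembership _≟ᴬ_ using (_∈?_; _∉?_)

  Unique∧⊆⇒length≤ : ∀ {xs ys : List A} → Unique xs → xs ⊆ ys → length xs ≤ length ys
  Unique∧⊆⇒length≤ {[]}     _           _   = z≤n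
  Unique∧⊆⇒length≤ {x ∷ xs} {ys} (x∉xs ∷ u) sub =
    ≤-<-trans (Unique∧⊆⇒length≤ u xs⊆ys∖x) (filter-notAll ≢x? ys x∈ys)
    where
    ≢x? : Decidable (x ≢_)
    ≢x? y = ¬? (x ≟ᴬ y)
    xs⊆ys∖x : xs ⊆ filter ≢x? ys
    xs⊆ys∖x y∈xs = ∈-filter⁺ ≢x? (sub (there y∈xs)) (All.lookup x∉xs y∈xs)
    x∈ys : Any (∁ (x ≢_)) ys
    x∈ys = Any.map (λ x≡y x≢y → x≢y x≡y) (sub (here refl))

  length-filter-∁ : ∀ {p} {P : Pred A p} (P? : Decidable P) (xs : List A) →
    length xs ≤ length (filter P? xs) + length (filter (∁? P?) xs)
  length-filter-∁ P? []       = z≤n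
  length-filter-∁ P? (x ∷ xs) with P? x
  ... | yes _ = s≤s (length-filter-∁ P? xs)
  ... | no  _ rewrite +-suc (length (filter P? xs)) (length (filter (∁? P?) xs)) =
    s≤s (length-filter-∁ P? xs)

  length-filter-∉ : ∀ {xs} (ds : List A) → Unique xs →
    length xs ≤ length (filter (_∉? ds) xs) + length ds
  length-filter-∉ {xs} ds u = ≤-trans (length-filter-∁ (_∉? ds) xs)
    (+-monoʳ-≤ (length (filter (_∉? ds) xs))
      (Unique∧⊆⇒length≤ (Unique.filter⁺ (∁? (_∉? ds)) u) removed⊆ds))
    where
    removed⊆ds : filter (∁? (_∉? ds)) xs ⊆ ds
    removed⊆ds {y} m = decidable-stable (y ∈? ds) (proj₂ (∈-filter⁻ (∁? (_∉? ds)) {xs = xs} m))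

Dominated : ∀ {n} → Graph n → List (Fin n) → Fin n → Set
Dominated G us w = Any (λ u → adj G u w ≡ true) us

dominated⇒≢-undominated : ∀ {n} {G : Graph n} {us z w} →
  Dominated G us z → All (λ u → adj G u w ≡ false) us → z ≢ w
dominated⇒≢-undominated dom free refl =
  All.lookupWith (λ w-free z-adj → contradiction (trans (sym w-free) z-adj) λ ()) free dom

module _ {n ℓ} {G H : Graph n} {P : Pred (Fin n) ℓ} (P? : Decidable P)
         (agree : ∀ {y} → P y → ∀ w → adj H y w ≡ adj G y w) where

  LCond-filter : ∀ {prev prev′} s → prev′ ⊆ prev → All P prev′ →
    LCond H prev s → LCond G prev′ (filter P? s)
  LCond-filter []      _   _     _ = tt
  LCond-filter {prev′ = prev′} (x ∷ s) sub P-prev′ ((w , x~w , w-free) , rest) with P? x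
  ... | no  _  = LCond-filter s (λ m → there (sub m)) P-prev′ rest
  ... | yes px = (w , closedNbhd x~w , All.tabulate w-free′) ,
                 LCond-filter s (∷⁺ʳ x sub) (px ∷ P-prev′) rest
    where
    closedNbhd : InClosedNbhd H x w → InClosedNbhd G x w
    closedNbhd (inj₁ w≡x) = inj₁ w≡x
    closedNbhd (inj₂ x~w) = inj₂ (trans (sym (agree px w)) x~w)
    w-free′ : ∀ {u} → u ∈ prev′ → adj G u w ≡ false
    w-free′ m = trans (sym (agree (All.lookup P-prev′ m) w)) (All.lookup w-free (sub m))

  IsLSequence-filter : ∀ {s} → IsLSequence H s → IsLSequence G (filter P? s)
  IsLSequence-filter {s} (u , L) = Unique.filter⁺ P? u , LCond-filter s (λ ()) [] L

module _ {n} (G : Graph n) (e : Edge G) where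
  private
    a b : Fin n
    a = proj₁ e
    b = proj₁ (proj₂ e)
    H : Graph n
    H = deleteEdge G e

  endpoints : List (Fin n)
  endpoints = a ∷ b ∷ []

  ∉endpoints? : Decidable (_∉ endpoints)
  ∉endpoints? x = DecMembership._∉?_ _≟_ x endpoints

  Ends : Fin n → Fin n → Set
  Ends x w = (x ≡ a × w ≡ b) ⊎ (w ≡ a × x ≡ b)

  isPair⇒Ends : ∀ x w → isPair a b x w ≡ true → Ends x w
  isPair⇒Ends x w eq with x ≟ a | w ≟ b | w ≟ a | x ≟ b
  ... | yes x≡a | yes w≡b | _       | _       = inj₁ (x≡a , w≡b)
  ... | _       | _       | yes w≡a | yes x≡b = inj₂ (w≡a , x≡b)
  ... | no _    | _       | no _    | _       = contradiction eq λ ()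
  ... | no _    | _       | yes _   | no _    = contradiction eq λ ()
  ... | yes _   | no _    | no _    | _       = contradiction eq λ ()
  ... | yes _   | no _    | yes _   | no _    = contradiction eq λ ()

  isPair-away : ∀ {x} → x ∉ endpoints → ∀ w → isPair a b x w ≡ false
  isPair-away {x} x∉ w with x ≟ a | x ≟ b
  ... | yes x≡a | _       = contradiction (here x≡a) x∉
  ... | no _    | yes x≡b = contradiction (there (here x≡b)) x∉
  ... | no _    | no _    = ∧-zeroʳ _

  Ends⇒endpoint∈ : ∀ {x w z} → Ends x w → z ∈ endpoints → z ≡ x ⊎ z ≡ w
  Ends⇒endpoint∈ (inj₁ (refl , refl)) (here refl)         = inj₁ refl
  Ends⇒endpoint∈ (inj₁ (refl , refl)) (there (here refl)) = inj₂ refl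
  Ends⇒endpoint∈ (inj₂ (refl , refl)) (here refl)         = inj₂ refl
  Ends⇒endpoint∈ (inj₂ (refl , refl)) (there (here refl)) = inj₁ refl

  Ends⇒∈endpoints : ∀ {x w} → Ends x w → x ∈ endpoints
  Ends⇒∈endpoints (inj₁ (x≡a , _)) = here x≡a
  Ends⇒∈endpoints (inj₂ (_ , x≡b)) = there (here x≡b)

  adj-deleteEdge-false : ∀ {x w} → adj G x w ≡ false → adj H x w ≡ false
  adj-deleteEdge-false {x} {w} x≁w = cong (λ c → c ∧ not (isPair a b x w)) x≁w

  adj-deleteEdge-away : ∀ {x} → x ∉ endpoints → ∀ w → adj H x w ≡ adj G x w
  adj-deleteEdge-away {x} x∉ w =
    trans (cong (λ c → adj G x w ∧ not c) (isPair-away x∉ w)) (∧-identityʳ (adj G x w))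

  closedNbhd-deleteEdge : ∀ {x w} → InClosedNbhd G x w → InClosedNbhd H x w ⊎ Ends x w
  closedNbhd-deleteEdge     (inj₁ w≡x) = inj₁ (inj₁ w≡x)
  closedNbhd-deleteEdge {x} {w} (inj₂ x~w) with isPair a b x w in eq
  ... | true  = inj₂ (isPair⇒Ends x w eq)
  ... | false rewrite x~w = inj₁ (inj₂ refl)

  LCond-deleteEdge-dominated : ∀ {z prev prev′} s → z ∈ endpoints → Dominated G prev z →
    z ∉ s → prev′ ⊆ prev → LCond G prev s → LCond H prev′ s
  LCond-deleteEdge-dominated []      _  _   _  _   _ = tt
  LCond-deleteEdge-dominated {z} (x ∷ s) z∈ dom z∉ sub ((w , x~w , w-free) , rest) =
    (w , x~ₕw , anti-mono sub (All.map adj-deleteEdge-false w-free)) ,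
    LCond-deleteEdge-dominated s z∈ (there dom) (λ m → z∉ (there m)) (∷⁺ʳ x sub) rest
    where
    x~ₕw : InClosedNbhd H x w
    x~ₕw with closedNbhd-deleteEdge x~w
    ... | inj₁ x~w′ = x~w′
    ... | inj₂ ends with Ends⇒endpoint∈ ends z∈
    ...   | inj₁ z≡x = contradiction (here z≡x) z∉
    ...   | inj₂ z≡w = contradiction z≡w (dominated⇒≢-undominated {G = G} dom w-free)

  LCond-deleteEdge : ∀ {prev prev′} s → prev′ ⊆ prev → Unique s → LCond G prev s →
    ∃ λ s′ → s′ ⊆ s × Unique s′ × LCond H prev′ s′ × length s ≤ suc (length s′)
  LCond-deleteEdge []      _   _          _ = [] , (λ ()) , [] , tt , z≤n
  LCond-deleteEdge {prev} {prev′} (x ∷ s) sub (x∉s ∷ u) ((w , x~w , w-free) , rest) =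
    cases (closedNbhd-deleteEdge x~w)
    where
    Result : Set
    Result = ∃ λ s′ → s′ ⊆ x ∷ s × Unique s′ × LCond H prev′ s′ × length (x ∷ s) ≤ suc (length s′)

    keep : ∀ v → InClosedNbhd H x v → All (λ y → adj G y v ≡ false) prev → Result
    keep v x~ₕv v-free with LCond-deleteEdge s (∷⁺ʳ x sub) u rest
    ... | s′ , s′⊆s , u′ , L′ , len =
      x ∷ s′ , ∷⁺ʳ x s′⊆s , anti-mono s′⊆s x∉s ∷ u′ ,
      ((v , x~ₕv , anti-mono sub (All.map adj-deleteEdge-false v-free)) , L′) ,
      s≤s len

    cases : InClosedNbhd H x w ⊎ Ends x w → Result
    cases (inj₁ x~ₕw) = keep w x~ₕw w-free
    cases (inj₂ ends) with any? (λ y → adj G y x Bool.≟ true) prev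
    ... | no ¬dom = keep x (inj₁ refl) (All.map ¬-not (¬Any⇒All¬ prev ¬dom))
    ... | yes dom = s , xs⊆x∷xs s x , u ,
                    LCond-deleteEdge-dominated s (Ends⇒∈endpoints ends) (there dom)
                      (All¬⇒¬Any x∉s) (λ m → there (sub m)) rest ,
                    ≤-refl

  IsLSequence-deleteEdge : ∀ {s} → IsLSequence G s →
    ∃ λ s′ → IsLSequence H s′ × length s ≤ suc (length s′)
  IsLSequence-deleteEdge {s} (u , L) =
    let s′ , _ , u′ , L′ , len = LCond-deleteEdge s (λ ()) u L in s′ , (u′ , L′) , len

  IsLSequence-removeEndpoints : ∀ {s} → IsLSequence H s →
    IsLSequence G (filter ∉endpoints? s)
  IsLSequence-removeEndpoints =
    IsLSequence-filter {G = G} {H = H} ∉endpoints? adj-deleteEdge-away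

theorem4p1 : ∀ {n : ℕ} (G : Graph n) (e : Edge G) (k k′ : ℕ) →
    IsLGrundyNumber G k → IsLGrundyNumber (deleteEdge G e) k′ →
    (k ∸ 1 ≤ k′) × (k′ ≤ k + 2)
theorem4p1 G e _ _ ((s , Ls , refl) , maxG) ((s′ , Ls′ , refl) , maxG−e) = lower , upper
  where
  lower : length s ∸ 1 ≤ length s′
  lower = let s″ , Ls″ , len = IsLSequence-deleteEdge G e Ls in
          ≤-trans (∸-monoˡ-≤ 1 len) (maxG−e s″ Ls″)

  t : List (Fin _)
  t = filter (∉endpoints? G e) s′

  upper : length s′ ≤ length s + 2
  upper = begin
    length s′     ≤⟨ length-filter-∉ _≟_ (endpoints G e) (proj₁ Ls′) ⟩
    length t + 2  ≤⟨ +-monoˡ-≤ 2 (maxG t (IsLSequence-removeEndpoints G e Ls′)) ⟩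
    length s + 2  ∎
    where open ≤-Reasoning
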